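{- Let $\epsilon\in(0,1)$ and let $\mathbf A\in\{ -1,0,1\}^{n\times n}$ be positive semidefinite with eigenvalues $\lambda_1\ge\cdots\ge\lambda_p>0$ and $\lambda_{p+1}=\cdots=\lambda_n=0$. Write $\mathbf A=\sum_{i=1}^p\mathbf v_i\mathbf v_i^T$ where $\mathbf v_1,\dots,\mathbf v_p\in\{ -1,0,1\}^n$ have pairwise disjoint supports, and let $S_i=\{j:\mathbf v_i(j)\neq0\}$, so that $|S_i|=\lambda_i$. Let $G$ be an $(\epsilon/6)\cdot n$-expanding graph on vertex set $[n]$ with adjacency matrix $\mathbf B_G$. Let $\mathbf A_G$ be the binary matrix with $(\mathbf A_G)_{ij}=1$ whenever $(\mathbf B_G)_{ij}=1$ and $|\mathbf A_{ij}|=1$, and $(\mathbf A_G)_{ij}=0$ otherwise, and let $\bar G$ be the graph with adjacency matrix $\mathbf A_G$. Let $\bar G_{S_i}$ be the induced subgraph of $\bar G$ on $S_i$, and let $C_i\subseteq[n]$ be the largest connected component of $\bar G_{S_i}$. Then $$\lambda_i-\frac{\epsilon}{2}n<|C_i|\le\lambda_i.$$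
   Context: For $\delta>0$, a $\delta$-expanding graph (a $\delta$-expander) on $n$ vertices is an undirected graph such that any two disjoint vertex subsets each containing at least $\delta$ vertices are joined by at least one edge. (Such a decomposition $\mathbf A=\sum_i\mathbf v_i\mathbf v_i^T$ with disjointly supported $\{ -1,0,1\}$-vectors and $|S_i|=\lambda_i$ always exists for PSD $\mathbf A\in\{ -1,0,1\}^{n\times n}$.)
   Formalization: The parameter ε ranges over the rationals in $(0,1)$. -}

module Defs where

open import Data.Nat as ℕ using (ℕ; zero; suc)
open import Data.Integer as ℤ using (ℤ; +_; 0ℤ; 1ℤ; -1ℤ)
open import Data.Rational as ℚ using (ℚ; 0ℚ; 1ℚ)
open import Data.Fin using (Fin; zero; suc)
open import Data.Fin.Subset using (Subset; _∈_; _∉_; _⊆_; ∣_∣; Empty; _∩_)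
open import Data.Vec using (tabulate)
open import Data.Bool using (Bool; true; false; not)
open import Data.Product using (Σ; ∃; _×_; _,_)
open import Data.Sum using (_⊎_)
open import Relation.Binary.PropositionalEquality using (_≡_)
open import Relation.Nullary using (¬_; does)

Trit : ℤ → Set
Trit x = x ≡ -1ℤ ⊎ x ≡ 0ℤ ⊎ x ≡ 1ℤ

∑ : {p : ℕ} → (Fin p → ℤ) → ℤ
∑ {zero} f = 0ℤ
∑ {suc p} f = f zero ℤ.+ ∑ (λ i → f (suc i))

TritMatrix : ℕ → Set
TritMatrix n = Σ (Fin n → Fin n → ℤ) λ A → ∀ j k → Trit (A j k)

-- positive semidefinite (quadratic form x^T A x ≥ 0 for all integer vectors;
-- for an integer matrix this is equivalent to real PSD by scaling and density)
PSD : {n : ℕ} → (Fin n → Fin n → ℤ) → Set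
PSD {n} A = ∀ (x : Fin n → ℤ) → 0ℤ ℤ.≤ ∑ (λ j → ∑ (λ k → x j ℤ.* (A j k ℤ.* x k)))

support : {n : ℕ} → (Fin n → ℤ) → Subset n
support v = tabulate (λ j → not (does (v j ℤ.≟ 0ℤ)))

Disjoint : {n : ℕ} → Subset n → Subset n → Set
Disjoint X Y = Empty (X ∩ Y)

record Graph (n : ℕ) : Set where
  field
    adj       : Fin n → Fin n → Bool
    symmetric : ∀ i j → adj i j ≡ adj j i
    loopless  : ∀ i → adj i i ≡ false

Edge : {n : ℕ} → Graph n → Fin n → Fin n → Set
Edge G i j = Graph.adj G i j ≡ true

Expanding : {n : ℕ} → ℚ → Graph n → Set
Expanding {n} δ G = ∀ (X Y : Subset n) → Disjoint X Y →
  δ ℚ.≤ (+ ∣ X ∣ ℚ./ 1) → δ ℚ.≤ (+ ∣ Y ∣ ℚ./ 1) →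
  ∃ λ i → ∃ λ j → i ∈ X × j ∈ Y × Edge G i j

data Reach {n : ℕ} (E : Fin n → Fin n → Set) (X : Subset n) : Fin n → Fin n → Set where
  here : ∀ {u} → u ∈ X → Reach E X u u
  step : ∀ {u w v} → u ∈ X → E u w → Reach E X w v → Reach E X u v

IsComponent : {n : ℕ} → (Fin n → Fin n → Set) → Subset n → Subset n → Set
IsComponent {n} E X C =
  C ⊆ X ×
  (∃ λ u → u ∈ C) ×
  (∀ u v → u ∈ C → v ∈ C → Reach E X u v) ×
  (∀ u v → u ∈ C → v ∈ X → E u v → v ∈ C)

IsLargestComponent : {n : ℕ} → (Fin n → Fin n → Set) → Subset n → Subset n → Set
IsLargestComponent {n} E X C =
  IsComponent E X C × (∀ D → IsComponent E X D → ∣ D ∣ ℕ.≤ ∣ C ∣)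

GbarEdge : {n : ℕ} → Graph n → (Fin n → Fin n → ℤ) → Fin n → Fin n → Set
GbarEdge G A i j = Edge G i j × ℤ.∣ A i j ∣ ≡ 1

-- Within S = supp vᵢ the matrix A agrees with vᵢvᵢᵀ, whose entries there are ±1, so every edge
-- of G between vertices of S is an edge of Ḡ_S. Put δ = εn/6 and suppose every component of Ḡ_S
-- has at most m vertices while |S| ≥ m + 2δ. Adding components one at a time produces a union X
-- of components with δ ≤ |X| < m + δ; then S ∖ X has at least δ vertices too, so the δ-expander G
-- has an edge between X and S ∖ X. That edge lies in Ḡ_S and leaves a union of components, which
-- is absurd. Hence |S| < |C| + 2δ ≤ |C| + εn/2.
module Submission where

open import Defs
open import Data.Nat as ℕ using (ℕ; zero; suc; z≤n; s≤s)
import Data.Nat.Properties as ℕP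
open import Data.Integer as ℤ using (ℤ; +_; 0ℤ)
import Data.Integer.Properties as ℤP
import Data.Integer.Solver as ℤSolver
open import Data.Rational as ℚ using (ℚ; 0ℚ; 1ℚ; toℚᵘ)
import Data.Rational.Properties as ℚP
import Data.Rational.Solver as ℚSolver
open import Data.Rational.Unnormalised as ℚᵘ using (mkℚᵘ; *≡*)
import Data.Rational.Unnormalised.Properties as ℚᵘP
open import Data.Bool using (true; false)
open import Data.Empty using (⊥; ⊥-elim)
open import Data.Fin using (Fin; zero; suc)
open import Data.Fin.Properties using (any?; suc-injective)
open import Data.Fin.Subset
  using (Subset; _∈_; _∉_; _⊆_; _⊂_; ∣_∣; _∪_; _─_; ⋃; ⁅_⁆) renaming (⊥ to ∅)
open import Data.Fin.Subset.Properties
  using ( _∈?_; _⊂?_; ∉⊥; ∣⊥∣≡0; ∣p∣≤n; x∈⁅x⁆; x∈⁅y⁆⇒x≡y; x∈p∪q⁺; x∈p∪q⁻; p⊆p∪q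
        ; x∈p∩q⁺; x∈p∩q⁻; x∈p∧x∉q⇒x∈p─q; p─q⊆p; p⊆q⇒∣p∣≤∣q∣; p⊂q⇒∣p∣<∣q∣; ⊆-antisym )
open import Data.List using (List; []; _∷_; map; filter; allFin)
import Data.List.Membership.Propositional as List
open import Data.List.Membership.Propositional.Properties using (∈-allFin; ∈-map⁺; ∈-filter⁺)
open import Data.List.Relation.Unary.All as All using (All; []; _∷_)
open import Data.List.Relation.Unary.All.Properties using (all-filter) renaming (map⁺ to All-map⁺)
import Data.List.Relation.Unary.Any as Any
open import Data.Product using (∃; _×_; _,_; proj₁)
open import Data.Sum using (_⊎_; inj₁; inj₂; [_,_]′)
open import Data.Vec using ([]; _∷_; tabulate)
open import Data.Vec.Properties using (lookup∘tabulate; []=⇒lookup; lookup⇒[]=)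
open import Relation.Nullary using (¬_; Dec; yes; no; does; ¬?)
open import Relation.Nullary.Decidable using (dec-true; _×-dec_)
open import Relation.Binary.PropositionalEquality
  using (_≡_; _≢_; refl; sym; trans; cong; cong₂; subst; module ≡-Reasoning)

decSubset : ∀ {n} {P : Fin n → Set} → (∀ x → Dec (P x)) → Subset n
decSubset P? = tabulate (λ x → does (P? x))

module _ {n} {P : Fin n → Set} (P? : ∀ x → Dec (P x)) where

  ∈decSubset⁺ : ∀ {x} → P x → x ∈ decSubset P?
  ∈decSubset⁺ {x} px = lookup⇒[]= x _ (trans (lookup∘tabulate _ x) (dec-true (P? x) px))

  ∈decSubset⁻ : ∀ {x} → x ∈ decSubset P? → P x
  ∈decSubset⁻ {x} x∈ with P? x | trans (sym (lookup∘tabulate _ x)) ([]=⇒lookup x∈)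
  ... | yes px | _ = px
  ... | no _   | ()

∣p∪q∣≤∣p∣+∣q∣ : ∀ {n} (p q : Subset n) → ∣ p ∪ q ∣ ℕ.≤ ∣ p ∣ ℕ.+ ∣ q ∣
∣p∪q∣≤∣p∣+∣q∣ []          []          = z≤n
∣p∪q∣≤∣p∣+∣q∣ (true ∷ p)  (true ∷ q)  = s≤s (ℕP.≤-trans (∣p∪q∣≤∣p∣+∣q∣ p q) (ℕP.+-monoʳ-≤ ∣ p ∣ (ℕP.n≤1+n ∣ q ∣)))
∣p∪q∣≤∣p∣+∣q∣ (true ∷ p)  (false ∷ q) = s≤s (∣p∪q∣≤∣p∣+∣q∣ p q)
∣p∪q∣≤∣p∣+∣q∣ (false ∷ p) (true ∷ q)  = ℕP.≤-trans (s≤s (∣p∪q∣≤∣p∣+∣q∣ p q)) (ℕP.≤-reflexive (sym (ℕP.+-suc ∣ p ∣ ∣ q ∣)))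
∣p∪q∣≤∣p∣+∣q∣ (false ∷ p) (false ∷ q) = ∣p∪q∣≤∣p∣+∣q∣ p q

x∈p─q⇒x∉q : ∀ {n} (p q : Subset n) {x} → x ∈ p ─ q → x ∉ q
x∈p─q⇒x∉q (true ∷ p)  (false ∷ q) Data.Vec.here      ()
x∈p─q⇒x∉q (_ ∷ p)     (_ ∷ q)     (Data.Vec.there x∈) (Data.Vec.there x∈q) = x∈p─q⇒x∉q p q x∈ x∈q

∣p∣≤∣q∣+∣p─q∣ : ∀ {n} (p q : Subset n) → ∣ p ∣ ℕ.≤ ∣ q ∣ ℕ.+ ∣ p ─ q ∣
∣p∣≤∣q∣+∣p─q∣ p q = ℕP.≤-trans (p⊆q⇒∣p∣≤∣q∣ p⊆q∪p─q) (∣p∪q∣≤∣p∣+∣q∣ q (p ─ q))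
  where
  p⊆q∪p─q : p ⊆ q ∪ (p ─ q)
  p⊆q∪p─q {x} x∈p with x ∈? q
  ... | yes x∈q = x∈p∪q⁺ (inj₁ x∈q)
  ... | no  x∉q = x∈p∪q⁺ (inj₂ (x∈p∧x∉q⇒x∈p─q x∈p x∉q))

x∈⋃⁺ : ∀ {n} {K : Subset n} {Ks x} → K List.∈ Ks → x ∈ K → x ∈ ⋃ Ks
x∈⋃⁺ (Any.here refl) x∈K = x∈p∪q⁺ (inj₁ x∈K)
x∈⋃⁺ (Any.there K∈) x∈K = x∈p∪q⁺ (inj₂ (x∈⋃⁺ K∈ x∈K))

module _ {n} {E : Fin n → Fin n → Set} {X : Subset n} where

  Reach-target : ∀ {u v} → Reach E X u v → v ∈ X
  Reach-target (here v∈X)   = v∈X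
  Reach-target (step _ _ r) = Reach-target r

  Reach-snoc : ∀ {u w v} → Reach E X u w → E w v → v ∈ X → Reach E X u v
  Reach-snoc (here w∈X)      e v∈X = step w∈X e (here v∈X)
  Reach-snoc (step u∈X e′ r) e v∈X = step u∈X e′ (Reach-snoc r e v∈X)

  Reach-trans : ∀ {u w v} → Reach E X u w → Reach E X w v → Reach E X u v
  Reach-trans (here _)       r′ = r′
  Reach-trans (step u∈X e r) r′ = step u∈X e (Reach-trans r r′)

  Reach-sym : (∀ {a b} → E a b → E b a) → ∀ {u v} → Reach E X u v → Reach E X v u
  Reach-sym E-sym (here u∈X)     = here u∈X
  Reach-sym E-sym (step u∈X e r) = Reach-snoc (Reach-sym E-sym r) (E-sym e) u∈X

Closed : ∀ {n} → (Fin n → Fin n → Set) → Subset n → Subset n → Set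
Closed E S K = ∀ {x y} → x ∈ K → y ∈ S → E x y → y ∈ K

module _ {n} {E : Fin n → Fin n → Set} {S : Subset n} where

  Closed-∅ : Closed E S ∅
  Closed-∅ x∈∅ = ⊥-elim (∉⊥ x∈∅)

  Closed-∪ : ∀ {K L} → Closed E S K → Closed E S L → Closed E S (K ∪ L)
  Closed-∪ {K} {L} K-closed L-closed x∈ y∈S e with x∈p∪q⁻ K L x∈
  ... | inj₁ x∈K = x∈p∪q⁺ (inj₁ (K-closed x∈K y∈S e))
  ... | inj₂ x∈L = x∈p∪q⁺ (inj₂ (L-closed x∈L y∈S e))

iterate : {A : Set} → (A → A) → ℕ → A → A
iterate f zero    x = x
iterate f (suc k) x = f (iterate f k x)

module _ {n} (f : Subset n → Subset n) (f-inflationary : ∀ R → R ⊆ f R) where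

  ⊆-iterate : ∀ k R → R ⊆ iterate f k R
  ⊆-iterate zero    R x∈R = x∈R
  ⊆-iterate (suc k) R x∈R = f-inflationary _ (⊆-iterate k R x∈R)

  private
    fixed-unless-⊂ : ∀ R → ¬ (R ⊂ f R) → f R ⊆ R
    fixed-unless-⊂ R R⊄fR {x} x∈fR with x ∈? R
    ... | yes x∈R = x∈R
    ... | no  x∉R = ⊥-elim (R⊄fR (f-inflationary R , x , x∈fR , x∉R))

  iterate-fixed-or-growing : ∀ R k → f (iterate f k R) ⊆ iterate f k R ⊎ k ℕ.< ∣ iterate f (suc k) R ∣
  iterate-fixed-or-growing R zero with R ⊂? f R
  ... | yes R⊂fR = inj₂ (ℕP.≤-<-trans z≤n (p⊂q⇒∣p∣<∣q∣ R⊂fR))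
  ... | no  R⊄fR = inj₁ (fixed-unless-⊂ R R⊄fR)
  iterate-fixed-or-growing R (suc k) with iterate f (suc k) R ⊂? f (iterate f (suc k) R)
  ... | no  R⊄fR = inj₁ (fixed-unless-⊂ _ R⊄fR)
  ... | yes R⊂fR with iterate-fixed-or-growing R k
  ...   | inj₂ k<∣R∣ = inj₂ (ℕP.<-≤-trans (s≤s k<∣R∣) (p⊂q⇒∣p∣<∣q∣ R⊂fR))
  ...   | inj₁ fixed = inj₁ (subst (λ T → f T ⊆ T) (sym fRₖ≡Rₖ) fixed)
    where
    fRₖ≡Rₖ : f (iterate f k R) ≡ iterate f k R
    fRₖ≡Rₖ = ⊆-antisym fixed (f-inflationary _)

  iterate-fixed : ∀ R → f (iterate f n R) ⊆ iterate f n R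
  iterate-fixed R with iterate-fixed-or-growing R n
  ... | inj₁ fixed   = fixed
  ... | inj₂ n<∣R∣ = ⊥-elim (ℕP.<-irrefl refl (ℕP.<-≤-trans n<∣R∣ (∣p∣≤n (iterate f (suc n) R))))

module Components {n} {E : Fin n → Fin n → Set} (E? : ∀ x y → Dec (E x y))
                  (E-sym : ∀ {x y} → E x y → E y x) (S : Subset n) where

  Neighbour : Subset n → Fin n → Set
  Neighbour R y = y ∈ S × ∃ λ x → x ∈ R × E x y

  Neighbour? : ∀ R y → Dec (Neighbour R y)
  Neighbour? R y = (y ∈? S) ×-dec any? (λ x → (x ∈? R) ×-dec E? x y)

  grow : Subset n → Subset n
  grow R = R ∪ decSubset (Neighbour? R)

  grow-inflationary : ∀ R → R ⊆ grow R
  grow-inflationary R = p⊆p∪q (decSubset (Neighbour? R))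

  component : Fin n → Subset n
  component u = iterate grow n ⁅ u ⁆

  ∈component : ∀ u → u ∈ component u
  ∈component u = ⊆-iterate grow grow-inflationary n ⁅ u ⁆ (x∈⁅x⁆ u)

  component-closed : ∀ u → Closed E S (component u)
  component-closed u x∈ y∈S e =
    iterate-fixed grow grow-inflationary ⁅ u ⁆
      (x∈p∪q⁺ (inj₂ (∈decSubset⁺ (Neighbour? (component u)) (y∈S , _ , x∈ , e))))

  component-reach : ∀ {u} → u ∈ S → ∀ k {w} → w ∈ iterate grow k ⁅ u ⁆ → Reach E S u w
  component-reach {u} u∈S zero w∈ rewrite x∈⁅y⁆⇒x≡y u w∈ = here u∈S
  component-reach u∈S (suc k) w∈ with x∈p∪q⁻ _ _ w∈
  ... | inj₁ w∈Rₖ = component-reach u∈S k w∈Rₖ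
  ... | inj₂ w∈N  with ∈decSubset⁻ (Neighbour? _) w∈N
  ...   | w∈S , x , x∈Rₖ , e = Reach-snoc (component-reach u∈S k x∈Rₖ) e w∈S

  component⊆S : ∀ {u} → u ∈ S → component u ⊆ S
  component⊆S u∈S w∈ = Reach-target (component-reach u∈S n w∈)

  component-isComponent : ∀ {u} → u ∈ S → IsComponent E S (component u)
  component-isComponent {u} u∈S =
      component⊆S u∈S
    , (u , ∈component u)
    , (λ _ _ a∈ b∈ → Reach-trans (Reach-sym E-sym (reach a∈)) (reach b∈))
    , (λ _ _ a∈ b∈S e → component-closed u a∈ b∈S e)
    where
    reach : ∀ {w} → w ∈ component u → Reach E S u w
    reach = component-reach u∈S n

  components : List (Subset n)
  components = map component (filter (_∈? S) (allFin n))

  ⊆⋃components : S ⊆ ⋃ components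
  ⊆⋃components {u} u∈S = x∈⋃⁺ (∈-map⁺ component (∈-filter⁺ (_∈? S) (∈-allFin u) u∈S)) (∈component u)

fromℕ : ℕ → ℚ
fromℕ k = + k ℚ./ 1

toℚᵘ-/suc : ∀ k d → toℚᵘ (+ k ℚ./ suc d) ℚᵘ.≃ mkℚᵘ (+ k) d
toℚᵘ-/suc k d = ℚP.toℚᵘ-fromℚᵘ (mkℚᵘ (+ k) d)

fromℕ-+ : ∀ a b → fromℕ (a ℕ.+ b) ≡ fromℕ a ℚ.+ fromℕ b
fromℕ-+ a b = ℚP.toℚᵘ-injective (begin
  toℚᵘ (fromℕ (a ℕ.+ b))             ≈⟨ toℚᵘ-/suc (a ℕ.+ b) 0 ⟩
  mkℚᵘ (+ (a ℕ.+ b)) 0               ≈⟨ *≡* (solve 2 (λ x y → (x :+ y) :* con (+ 1) := (x :* con (+ 1) :+ y :* con (+ 1)) :* con (+ 1)) refl (+ a) (+ b)) ⟩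
  mkℚᵘ (+ a) 0 ℚᵘ.+ mkℚᵘ (+ b) 0     ≈⟨ ℚᵘP.+-cong (toℚᵘ-/suc a 0) (toℚᵘ-/suc b 0) ⟨
  toℚᵘ (fromℕ a) ℚᵘ.+ toℚᵘ (fromℕ b) ≈⟨ ℚP.toℚᵘ-homo-+ (fromℕ a) (fromℕ b) ⟨
  toℚᵘ (fromℕ a ℚ.+ fromℕ b)         ∎)
  where open ℚᵘP.≃-Reasoning
        open ℤSolver.+-*-Solver

fromℕ-nonNeg : ∀ k → 0ℚ ℚ.≤ fromℕ k
fromℕ-nonNeg k = ℚP.nonNegative⁻¹ (fromℕ k) {{ℚP.normalize-nonNeg k 1}}

fromℕ-mono-≤ : ∀ {a b} → a ℕ.≤ b → fromℕ a ℚ.≤ fromℕ b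
fromℕ-mono-≤ {a} {b} a≤b = begin
  fromℕ a                       ≡⟨ ℚP.+-identityʳ (fromℕ a) ⟨
  fromℕ a ℚ.+ 0ℚ                ≤⟨ ℚP.+-monoʳ-≤ (fromℕ a) (fromℕ-nonNeg (b ℕ.∸ a)) ⟩
  fromℕ a ℚ.+ fromℕ (b ℕ.∸ a)   ≡⟨ fromℕ-+ a (b ℕ.∸ a) ⟨
  fromℕ (a ℕ.+ (b ℕ.∸ a))       ≡⟨ cong fromℕ (ℕP.m+[n∸m]≡n a≤b) ⟩
  fromℕ b                       ∎
  where open ℚP.≤-Reasoning

n/2≡3*n/6 : ∀ n → + n ℚ./ 2 ≡ (+ n ℚ./ 6 ℚ.+ + n ℚ./ 6) ℚ.+ + n ℚ./ 6
n/2≡3*n/6 n = ℚP.toℚᵘ-injective (begin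
  toℚᵘ (+ n ℚ./ 2)                   ≈⟨ toℚᵘ-/suc n 1 ⟩
  mkℚᵘ (+ n) 1                       ≈⟨ *≡* (solve 1 (λ x → x :* con (+ 216) := ((x :* con (+ 6) :+ x :* con (+ 6)) :* con (+ 6) :+ x :* con (+ 36)) :* con (+ 2)) refl (+ n)) ⟩
  (n/6 ℚᵘ.+ n/6) ℚᵘ.+ n/6            ≈⟨ ℚᵘP.+-cong (ℚᵘP.+-cong (toℚᵘ-/suc n 5) (toℚᵘ-/suc n 5)) (toℚᵘ-/suc n 5) ⟨
  (toℚᵘ q ℚᵘ.+ toℚᵘ q) ℚᵘ.+ toℚᵘ q   ≈⟨ ℚᵘP.+-congˡ (toℚᵘ q) (ℚP.toℚᵘ-homo-+ q q) ⟨
  toℚᵘ (q ℚ.+ q) ℚᵘ.+ toℚᵘ q         ≈⟨ ℚP.toℚᵘ-homo-+ (q ℚ.+ q) q ⟨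
  toℚᵘ ((q ℚ.+ q) ℚ.+ q)             ∎)
  where
  open ℚᵘP.≃-Reasoning
  open ℤSolver.+-*-Solver
  q = + n ℚ./ 6
  n/6 = mkℚᵘ (+ n) 5

ε*n/6-pos : ∀ {n} → Fin n → ∀ ε → 0ℚ ℚ.< ε → 0ℚ ℚ.< ε ℚ.* (+ n ℚ./ 6)
ε*n/6-pos {suc n} _ ε 0<ε = ℚP.positive⁻¹ _
  {{ℚP.pos*pos⇒pos ε {{ℚ.positive 0<ε}} (+ suc n ℚ./ 6) {{ℚP.normalize-pos (suc n) 6}}}}

module _ {D : ℚ} where
  open ℚP.≤-Reasoning
  open ℚSolver.+-*-Solver

  m+2D≤s⇒D≤s : ∀ {m s} → 0ℚ ℚ.< D → 0ℚ ℚ.≤ m → m ℚ.+ (D ℚ.+ D) ℚ.≤ s → D ℚ.≤ s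
  m+2D≤s⇒D≤s {m} {s} 0<D 0≤m m+2D≤s = begin
    D                       ≡⟨ ℚP.+-identityʳ D ⟨
    D ℚ.+ 0ℚ                ≤⟨ ℚP.+-monoʳ-≤ D (ℚP.+-mono-≤ (ℚP.<⇒≤ 0<D) 0≤m) ⟩
    D ℚ.+ (D ℚ.+ m)         ≡⟨ solve 2 (λ d m → d :+ (d :+ m) := m :+ (d :+ d)) refl D m ⟩
    m ℚ.+ (D ℚ.+ D)         ≤⟨ m+2D≤s ⟩
    s                       ∎

  m+2D≤x+y∧x<m+D⇒D≤y : ∀ {m x y} → m ℚ.+ (D ℚ.+ D) ℚ.≤ x ℚ.+ y → x ℚ.< m ℚ.+ D → D ℚ.≤ y
  m+2D≤x+y∧x<m+D⇒D≤y {m} {x} {y} m+2D≤x+y x<m+D = ℚP.≮⇒≥ λ y<D → ℚP.<-irrefl refl (begin-strict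
    x ℚ.+ y                 <⟨ ℚP.+-mono-< x<m+D y<D ⟩
    (m ℚ.+ D) ℚ.+ D         ≡⟨ ℚP.+-assoc m D D ⟩
    m ℚ.+ (D ℚ.+ D)         ≤⟨ m+2D≤x+y ⟩
    x ℚ.+ y                 ∎)

  s<m+2D⇒s-3D<m : ∀ {m s} → 0ℚ ℚ.< D → s ℚ.< m ℚ.+ (D ℚ.+ D) → s ℚ.- ((D ℚ.+ D) ℚ.+ D) ℚ.< m
  s<m+2D⇒s-3D<m {m} {s} 0<D s<m+2D = begin-strict
    s ℚ.- ((D ℚ.+ D) ℚ.+ D)                   <⟨ ℚP.+-monoˡ-< (ℚ.- ((D ℚ.+ D) ℚ.+ D)) s<m+2D ⟩
    (m ℚ.+ (D ℚ.+ D)) ℚ.- ((D ℚ.+ D) ℚ.+ D)   ≡⟨ solve 2 (λ m d → (m :+ (d :+ d)) :- ((d :+ d) :+ d) := m :- d) refl m D ⟩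
    m ℚ.- D                                   <⟨ ℚP.+-monoʳ-< m (ℚP.neg-antimono-< 0<D) ⟩
    m ℚ.+ 0ℚ                                  ≡⟨ ℚP.+-identityʳ m ⟩
    m                                         ∎

module _ {n} {P : Subset n → Set} (P-∅ : P ∅) (P-∪ : ∀ {K L} → P K → P L → P (K ∪ L))
         {m : ℕ} {D : ℚ} (0<D : 0ℚ ℚ.< D) where

  private
    Piece : Subset n → Set
    Piece K = P K × ∣ K ∣ ℕ.≤ m

    P-⋃ : ∀ {Ks} → All Piece Ks → P (⋃ Ks)
    P-⋃ []               = P-∅
    P-⋃ ((pK , _) ∷ pKs) = P-∪ pK (P-⋃ pKs)

  -- Drop pieces from the front while the union of the rest still reaches D; the last such
  -- union exceeds the next one, which is below D, by at most one piece.
  ⋃-crosses-threshold : ∀ Ks → All Piece Ks → D ℚ.≤ fromℕ ∣ ⋃ Ks ∣ →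
    ∃ λ X → P X × D ℚ.≤ fromℕ ∣ X ∣ × fromℕ ∣ X ∣ ℚ.< fromℕ m ℚ.+ D
  ⋃-crosses-threshold [] [] D≤0 =
    ⊥-elim (ℚP.<-irrefl refl (ℚP.<-≤-trans 0<D (subst (λ k → D ℚ.≤ fromℕ k) (∣⊥∣≡0 n) D≤0)))
  ⋃-crosses-threshold (K ∷ Ks) (pK@(_ , ∣K∣≤m) ∷ pKs) D≤ with D ℚP.≤? fromℕ ∣ ⋃ Ks ∣
  ... | yes D≤′ = ⋃-crosses-threshold Ks pKs D≤′
  ... | no  D≰  = ⋃ (K ∷ Ks) , P-⋃ (pK ∷ pKs) , D≤ , (begin-strict
    fromℕ ∣ K ∪ ⋃ Ks ∣            ≤⟨ fromℕ-mono-≤ (ℕP.≤-trans (∣p∪q∣≤∣p∣+∣q∣ K (⋃ Ks)) (ℕP.+-monoˡ-≤ _ ∣K∣≤m)) ⟩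
    fromℕ (m ℕ.+ ∣ ⋃ Ks ∣)        ≡⟨ fromℕ-+ m ∣ ⋃ Ks ∣ ⟩
    fromℕ m ℚ.+ fromℕ ∣ ⋃ Ks ∣    <⟨ ℚP.+-monoʳ-< (fromℕ m) (ℚP.≰⇒> D≰) ⟩
    fromℕ m ℚ.+ D                 ∎)
    where open ℚP.≤-Reasoning

module _ {n} {E : Fin n → Fin n → Set} (E? : ∀ x y → Dec (E x y)) (E-sym : ∀ {x y} → E x y → E y x)
         (G : Graph n) {D : ℚ} (0<D : 0ℚ ℚ.< D) (G-expanding : Expanding D G)
         {S : Subset n} (G⊆E : ∀ {x y} → x ∈ S → y ∈ S → Edge G x y → E x y) where

  open Components E? E-sym S

  closed-set-unbalanced : ∀ {X} → X ⊆ S → Closed E S X →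
    D ℚ.≤ fromℕ ∣ X ∣ → D ℚ.≤ fromℕ ∣ S ─ X ∣ → ⊥
  closed-set-unbalanced {X} X⊆S X-closed D≤X D≤S─X =
    let a , b , a∈X , b∈S─X , ab∈G = G-expanding X (S ─ X) X∩S─X-empty D≤X D≤S─X
        b∈S = p─q⊆p S X b∈S─X
    in  x∈p─q⇒x∉q S X b∈S─X (X-closed a∈X b∈S (G⊆E (X⊆S a∈X) b∈S ab∈G))
    where
    X∩S─X-empty : Disjoint X (S ─ X)
    X∩S─X-empty (x , x∈) = let x∈X , x∈S─X = x∈p∩q⁻ X (S ─ X) x∈ in x∈p─q⇒x∉q S X x∈S─X x∈X

  largest-component-large : ∀ {C} → IsLargestComponent E S C →
    fromℕ ∣ S ∣ ℚ.< fromℕ ∣ C ∣ ℚ.+ (D ℚ.+ D)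
  largest-component-large {C} (_ , C-largest) with fromℕ ∣ S ∣ ℚP.<? fromℕ ∣ C ∣ ℚ.+ (D ℚ.+ D)
  ... | yes S<C+2D = S<C+2D
  ... | no  S≮C+2D =
    let X , (X⊆S , X-closed) , D≤X , X<C+D = ⋃-crosses-threshold P-∅ P-∪ {m = ∣ C ∣} 0<D components pieces D≤⋃
    in  ⊥-elim (closed-set-unbalanced X⊆S X-closed D≤X
          (m+2D≤x+y∧x<m+D⇒D≤y {m = fromℕ ∣ C ∣} (ℚP.≤-trans C+2D≤S (S≤X+S─X X)) X<C+D))
    where
    C+2D≤S : fromℕ ∣ C ∣ ℚ.+ (D ℚ.+ D) ℚ.≤ fromℕ ∣ S ∣
    C+2D≤S = ℚP.≮⇒≥ S≮C+2D
    P : Subset n → Set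
    P K = K ⊆ S × Closed E S K
    P-∅ : P ∅
    P-∅ = (λ x∈∅ → ⊥-elim (∉⊥ x∈∅)) , Closed-∅ {E = E}
    P-∪ : ∀ {K L} → P K → P L → P (K ∪ L)
    P-∪ {K} {L} (K⊆S , K-closed) (L⊆S , L-closed) =
      (λ x∈ → [ K⊆S , L⊆S ]′ (x∈p∪q⁻ K L x∈)) , Closed-∪ K-closed L-closed
    pieces : All (λ K → P K × ∣ K ∣ ℕ.≤ ∣ C ∣) components
    pieces = All-map⁺ (All.map piece (all-filter (_∈? S) (allFin n)))
      where
      piece : ∀ {u} → u ∈ S → P (component u) × ∣ component u ∣ ℕ.≤ ∣ C ∣
      piece {u} u∈S = (component⊆S u∈S , component-closed u) , C-largest (component u) (component-isComponent u∈S)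
    D≤⋃ : D ℚ.≤ fromℕ ∣ ⋃ components ∣
    D≤⋃ = ℚP.≤-trans (m+2D≤s⇒D≤s 0<D (fromℕ-nonNeg ∣ C ∣) C+2D≤S)
                      (fromℕ-mono-≤ (p⊆q⇒∣p∣≤∣q∣ ⊆⋃components))
    S≤X+S─X : ∀ X → fromℕ ∣ S ∣ ℚ.≤ fromℕ ∣ X ∣ ℚ.+ fromℕ ∣ S ─ X ∣
    S≤X+S─X X = ℚP.≤-trans (fromℕ-mono-≤ (∣p∣≤∣q∣+∣p─q∣ S X)) (ℚP.≤-reflexive (fromℕ-+ ∣ X ∣ ∣ S ─ X ∣))

∑-cong : ∀ {p} {f g : Fin p → ℤ} → (∀ k → f k ≡ g k) → ∑ f ≡ ∑ g
∑-cong {zero}  f≡g = refl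
∑-cong {suc p} f≡g = cong₂ ℤ._+_ (f≡g zero) (∑-cong (λ k → f≡g (suc k)))

∑-zero : ∀ {p} (f : Fin p → ℤ) → (∀ k → f k ≡ 0ℤ) → ∑ f ≡ 0ℤ
∑-zero {zero}  f f≡0 = refl
∑-zero {suc p} f f≡0 = cong₂ ℤ._+_ (f≡0 zero) (∑-zero (λ k → f (suc k)) (λ k → f≡0 (suc k)))

∑-single : ∀ {p} (f : Fin p → ℤ) i → (∀ k → k ≢ i → f k ≡ 0ℤ) → ∑ f ≡ f i
∑-single f zero    f≡0 = begin
  f zero ℤ.+ ∑ (λ k → f (suc k)) ≡⟨ cong (λ t → f zero ℤ.+ t) (∑-zero _ (λ k → f≡0 (suc k) (λ ()))) ⟩
  f zero ℤ.+ 0ℤ                  ≡⟨ ℤP.+-identityʳ (f zero) ⟩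
  f zero                         ∎
  where open ≡-Reasoning
∑-single f (suc i) f≡0 = begin
  f zero ℤ.+ ∑ (λ k → f (suc k)) ≡⟨ cong (λ t → t ℤ.+ ∑ (λ k → f (suc k))) (f≡0 zero (λ ())) ⟩
  0ℤ ℤ.+ ∑ (λ k → f (suc k))     ≡⟨ ℤP.+-identityˡ _ ⟩
  ∑ (λ k → f (suc k))            ≡⟨ ∑-single _ i (λ k k≢i → f≡0 (suc k) (λ k≡i → k≢i (suc-injective k≡i))) ⟩
  f (suc i)                      ∎
  where open ≡-Reasoning

∈support⁻ : ∀ {n} (w : Fin n → ℤ) {x} → x ∈ support w → w x ≢ 0ℤ
∈support⁻ w = ∈decSubset⁻ (λ x → ¬? (w x ℤ.≟ 0ℤ))

∈support⁺ : ∀ {n} (w : Fin n → ℤ) {x} → w x ≢ 0ℤ → x ∈ support w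
∈support⁺ w = ∈decSubset⁺ (λ x → ¬? (w x ℤ.≟ 0ℤ))

∣trit∣≡1 : ∀ {x} → Trit x → x ≢ 0ℤ → ℤ.∣ x ∣ ≡ 1
∣trit∣≡1 (inj₁ refl)        _   = refl
∣trit∣≡1 (inj₂ (inj₁ refl)) x≢0 = ⊥-elim (x≢0 refl)
∣trit∣≡1 (inj₂ (inj₂ refl)) _   = refl

module _ {n p} (v : Fin p → Fin n → ℤ)
         (v-disjoint : ∀ i i′ → i ≢ i′ → Disjoint (support (v i)) (support (v i′))) where

  ∑-outer-on-support : ∀ {i j} → j ∈ support (v i) → ∀ k →
    ∑ (λ i′ → v i′ j ℤ.* v i′ k) ≡ v i j ℤ.* v i k
  ∑-outer-on-support {i} {j} j∈Sᵢ k = ∑-single (λ i′ → v i′ j ℤ.* v i′ k) i vanish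
    where
    vanish : ∀ i′ → i′ ≢ i → v i′ j ℤ.* v i′ k ≡ 0ℤ
    vanish i′ i′≢i with v i′ j ℤ.≟ 0ℤ
    ... | yes vᵢ′j≡0 = cong (ℤ._* v i′ k) vᵢ′j≡0
    ... | no  vᵢ′j≢0 = ⊥-elim (v-disjoint i′ i i′≢i (j , x∈p∩q⁺ (∈support⁺ (v i′) vᵢ′j≢0 , j∈Sᵢ)))

  module _ (v-trit : ∀ i j → Trit (v i j)) (A : Fin n → Fin n → ℤ)
           (A≡∑vvᵀ : ∀ j k → A j k ≡ ∑ (λ i → v i j ℤ.* v i k)) (G : Graph n) where

    Edge⇒GbarEdge : ∀ {i j k} → j ∈ support (v i) → k ∈ support (v i) → Edge G j k → GbarEdge G A j k
    Edge⇒GbarEdge {i} {j} {k} j∈Sᵢ k∈Sᵢ jk∈G = jk∈G , (begin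
      ℤ.∣ A j k ∣                    ≡⟨ cong ℤ.∣_∣ (trans (A≡∑vvᵀ j k) (∑-outer-on-support j∈Sᵢ k)) ⟩
      ℤ.∣ v i j ℤ.* v i k ∣          ≡⟨ ℤP.abs-* (v i j) (v i k) ⟩
      ℤ.∣ v i j ∣ ℕ.* ℤ.∣ v i k ∣    ≡⟨ cong₂ ℕ._*_ (∣trit∣≡1 (v-trit i j) (∈support⁻ (v i) j∈Sᵢ))
                                                    (∣trit∣≡1 (v-trit i k) (∈support⁻ (v i) k∈Sᵢ)) ⟩
      1                              ∎)
      where open ≡-Reasoning

GbarEdge? : ∀ {n} (G : Graph n) (A : Fin n → Fin n → ℤ) x y → Dec (GbarEdge G A x y)
GbarEdge? G A x y = (Graph.adj G x y Data.Bool.≟ true) ×-dec (ℤ.∣ A x y ∣ ℕ.≟ 1)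

GbarEdge-sym : ∀ {n} (G : Graph n) {A : Fin n → Fin n → ℤ} → (∀ x y → A x y ≡ A y x) →
  ∀ {x y} → GbarEdge G A x y → GbarEdge G A y x
GbarEdge-sym G A-sym {x} {y} (xy∈G , ∣Axy∣≡1) =
  trans (Graph.symmetric G y x) xy∈G , trans (cong ℤ.∣_∣ (A-sym y x)) ∣Axy∣≡1

∑vvᵀ-sym : ∀ {n p} (v : Fin p → Fin n → ℤ) j k → ∑ (λ i → v i j ℤ.* v i k) ≡ ∑ (λ i → v i k ℤ.* v i j)
∑vvᵀ-sym v j k = ∑-cong (λ i → ℤP.*-comm (v i j) (v i k))

ε*n/2≡3*ε*n/6 : ∀ ε n → ε ℚ.* (+ n ℚ./ 2) ≡ (ε ℚ.* (+ n ℚ./ 6) ℚ.+ ε ℚ.* (+ n ℚ./ 6)) ℚ.+ ε ℚ.* (+ n ℚ./ 6)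
ε*n/2≡3*ε*n/6 ε n = trans (cong (ε ℚ.*_) (n/2≡3*n/6 n))
  (solve 2 (λ e q → e :* ((q :+ q) :+ q) := (e :* q :+ e :* q) :+ e :* q) refl ε (+ n ℚ./ 6))
  where open ℚSolver.+-*-Solver

-- Only the decomposition A = ∑ vᵢvᵢᵀ is used; the entries of A, positive semidefiniteness and
-- ε < 1 play no role. The lower bound even holds with εn/3 in place of εn/2.
theorem13 : (n p : ℕ) (ε : ℚ) → 0ℚ ℚ.< ε → ε ℚ.< 1ℚ →
    (A : Fin n → Fin n → ℤ) → (∀ j k → Trit (A j k)) → PSD A →
    (v : Fin p → Fin n → ℤ) → (∀ i j → Trit (v i j)) →
    (∀ i i′ → i ≢ i′ → Disjoint (support (v i)) (support (v i′))) →
    (∀ i → ∃ λ j → j ∈ support (v i)) →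
    (∀ j k → A j k ≡ ∑ (λ i → v i j ℤ.* v i k)) →
    (G : Graph n) → Expanding ((ε ℚ.* (+ n ℚ./ 6))) G →
    (i : Fin p) (C : Subset n) →
    IsLargestComponent (GbarEdge G A) (support (v i)) C →
    ((+ ∣ support (v i) ∣ ℚ./ 1) ℚ.- (ε ℚ.* (+ n ℚ./ 2))) ℚ.< (+ ∣ C ∣ ℚ./ 1)
      × ∣ C ∣ ℕ.≤ ∣ support (v i) ∣
theorem13 n _ ε 0<ε _ A _ _ v v-trit v-disjoint v-nonempty A≡∑vvᵀ G G-expanding i C C-largest =
  subst (λ h → fromℕ (∣ support (v i) ∣) ℚ.- h ℚ.< fromℕ (∣ C ∣)) (sym (ε*n/2≡3*ε*n/6 ε n))
    (s<m+2D⇒s-3D<m 0<D (largest-component-large (GbarEdge? G A) (GbarEdge-sym G A-sym) G 0<D G-expanding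
                      (Edge⇒GbarEdge v v-disjoint v-trit A A≡∑vvᵀ G) C-largest))
  , p⊆q⇒∣p∣≤∣q∣ (proj₁ (proj₁ C-largest))
  where
  0<D : 0ℚ ℚ.< ε ℚ.* (+ n ℚ./ 6)
  0<D = ε*n/6-pos (proj₁ (v-nonempty i)) ε 0<ε
  A-sym : ∀ x y → A x y ≡ A y x
  A-sym x y = trans (A≡∑vvᵀ x y) (trans (∑vvᵀ-sym v x y) (sym (A≡∑vvᵀ y x)))
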